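{- Let $n\ge1$, $k\in[n]$ and $u,w\in\mathfrak S_n$. Then $u\le_k w$ in the extended $k$-Bruhat order if and only if $u(a)\le w(a)$ for all $a\le k$ and $u(b)\ge w(b)$ for all $b>k$.
   Context: The extended $k$-Bruhat order on $\mathfrak S_n$: $u\le_k w$ iff there is a sequence $u=w_0,w_1,\dots,w_m=w$ ($m\ge0$) with $w_j=w_{j-1}t_{ab}$ for some transposition $t_{ab}$ of positions $a\le k<b$ satisfying $w_{j-1}(a)<w_{j-1}(b)$. -}

module Defs where

open import Data.Nat using (ℕ; _≤_; _<_)
open import Data.Fin using (Fin; toℕ)
import Data.Fin as F
open import Data.Fin.Permutation using (Permutation′; _⟨$⟩ʳ_; transpose; _∘ₚ_; _≈_)

-- Conventions: positions and values of a permutation of [n] are encoded as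
-- Fin n (0-based), so position a (1-based) ≤ k  iff  toℕ a < k.
-- The product w t_{ab} is the permutation x ↦ w (t_{ab} x), i.e.
-- transpose a b ∘ₚ w (stdlib's _∘ₚ_ applies its left argument first).

data Step (n k : ℕ) (w : Permutation′ n) : Permutation′ n → Set where
  step : (a b : Fin n) → toℕ a < k → k ≤ toℕ b →
         (w ⟨$⟩ʳ a) F.< (w ⟨$⟩ʳ b) →
         Step n k w (transpose a b ∘ₚ w)

data _≤[_,_]_ {n : ℕ} : Permutation′ n → ℕ → ℕ → Permutation′ n → Set where
  done : ∀ {k u w} → u ≈ w → u ≤[ n , k ] w
  more : ∀ {k u v w} → Step n k u v → v ≤[ n , k ] w → u ≤[ n , k ] w

-- A step u ↦ u t_{ab} (a ≤ k < b, u(a) < u(b)) raises the entry at the left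
-- position a and lowers the entry at the right position b, so along a chain
-- left entries only grow and right entries only shrink.
--
-- Conversely, let u satisfy the bounds with u ≠ w, and pick a right position j
-- with w(j) < u(j) and u(j) minimal (if there is none, u and w agree on the
-- right positions and then everywhere). By minimality, u and w agree at every
-- right position whose u-value is below u(j), so starting from v = w(j) the
-- map v ↦ w(u⁻¹(v)) only visits left positions and strictly increases v; it
-- thus reaches a left position a with w(j) ≤ u(a) < u(j) ≤ w(a). Then u t_{aj}
-- is a step, still satisfies the bounds, and has smaller Σₓ (w(x) ∸ u(x)).
module Submission where

open import Defs
open import Data.Nat using (ℕ; _≤_; _<_; _∸_; z≤n; _≤?_; _<?_)
open import Data.Nat.Properties
  using (≤-refl; ≤-trans; <⇒≤; <⇒≱; ≮⇒≥; +-mono-≤; +-mono-<-≤; +-mono-≤-<;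
         ≤-reflexive; ≤∧≮⇒≡; ≰⇒>; ∸-monoʳ-<; m≤n⇒m∸n≡0; +-0-monoid)
open import Data.Nat.Induction using (<-wellFounded)
open import Data.Fin using (Fin; toℕ; _≟_)
import Data.Fin as F
import Data.Fin.Properties as F
open import Data.Fin.Permutation
  using (Permutation′; _⟨$⟩ʳ_; _⟨$⟩ˡ_; transpose; _∘ₚ_; _≈_; inverseʳ)
open import Data.Product using (_×_; _,_; ∃)
open import Data.Vec.Functional using (Vector)
open import Algebra.Properties.Monoid.Sum +-0-monoid using (sum)
open import Function.Bundles using (_⇔_; mk⇔; Injection)
open import Function.Properties.Inverse using (↔⇒↣)
open import Induction.WellFounded using (Acc; acc)
open import Relation.Binary.PropositionalEquality
open import Relation.Nullary using (¬_; yes; no; contradiction)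
open import Relation.Nullary.Decidable using (_×-dec_)
open import Relation.Unary using (Pred; Decidable)

sum-mono-≤ : ∀ {n} {f g : Vector ℕ n} → (∀ i → f i ≤ g i) → sum f ≤ sum g
sum-mono-≤ {ℕ.zero}  f≤g = z≤n
sum-mono-≤ {ℕ.suc n} f≤g = +-mono-≤ (f≤g F.zero) (sum-mono-≤ (λ i → f≤g (F.suc i)))

sum-mono-< : ∀ {n} {f g : Vector ℕ n} → (∀ i → f i ≤ g i) →
             (i : Fin n) → f i < g i → sum f < sum g
sum-mono-< f≤g F.zero    fi<gi = +-mono-<-≤ fi<gi (sum-mono-≤ (λ i → f≤g (F.suc i)))
sum-mono-< f≤g (F.suc i) fi<gi =
  +-mono-≤-< (f≤g F.zero) (sum-mono-< (λ i → f≤g (F.suc i)) i fi<gi)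

∃-minimal : ∀ {n p} {P : Pred (Fin n) p} → Decidable P → (f : Fin n → ℕ) →
            ∃ P → ∃ λ m → P m × (∀ x → f x < f m → ¬ P x)
∃-minimal {P = P} P? f (j , Pj) = go j Pj (<-wellFounded (f j))
  where
  go : ∀ j → P j → Acc _<_ (f j) → ∃ λ m → P m × (∀ x → f x < f m → ¬ P x)
  go j Pj (acc rs) with F.any? (λ x → (f x <? f j) ×-dec P? x)
  ... | yes (x , fx<fj , Px) = go x Px (rs fx<fj)
  ... | no ∄smaller = j , Pj , λ x fx<fj Px → ∄smaller (x , fx<fj , Px)

permutation-injective : ∀ {n} (π : Permutation′ n) {x y : Fin n} →
                        π ⟨$⟩ʳ x ≡ π ⟨$⟩ʳ y → x ≡ y
permutation-injective π = Injection.injective (↔⇒↣ π)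

∘transpose-elim : ∀ {n p} (P : Fin n → Fin n → Set p) (u : Permutation′ n) (a b : Fin n) →
  P a (u ⟨$⟩ʳ b) → P b (u ⟨$⟩ʳ a) → (∀ x → x ≢ a → x ≢ b → P x (u ⟨$⟩ʳ x)) →
  ∀ x → P x (transpose a b ∘ₚ u ⟨$⟩ʳ x)
∘transpose-elim P u a b Pa Pb Pother x with x ≟ a
... | yes refl = Pa
... | no x≢a with x ≟ b
...   | yes refl = Pb
...   | no x≢b = Pother x x≢a x≢b

∘transpose-matchˡ : ∀ {n} (u : Permutation′ n) (a b : Fin n) →
                    transpose a b ∘ₚ u ⟨$⟩ʳ a ≡ u ⟨$⟩ʳ b
∘transpose-matchˡ u a b with a ≟ a
... | yes _   = refl
... | no a≢a = contradiction refl a≢a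

record _⊑[_]_ {n : ℕ} (u : Permutation′ n) (k : ℕ) (w : Permutation′ n) : Set where
  field
    left-≤  : ∀ a → toℕ a < k → u ⟨$⟩ʳ a F.≤ w ⟨$⟩ʳ a
    right-≥ : ∀ b → k ≤ toℕ b → w ⟨$⟩ʳ b F.≤ u ⟨$⟩ʳ b

open _⊑[_]_

⊑-reflexive : ∀ {n k} {u w : Permutation′ n} → u ≈ w → u ⊑[ k ] w
⊑-reflexive u≈w = record
  { left-≤  = λ a _ → F.≤-reflexive (u≈w a)
  ; right-≥ = λ b _ → F.≤-reflexive (sym (u≈w b))
  }

⊑-trans : ∀ {n k} {u v w : Permutation′ n} → u ⊑[ k ] v → v ⊑[ k ] w → u ⊑[ k ] w
⊑-trans u⊑v v⊑w = record
  { left-≤  = λ a a<k → F.≤-trans (left-≤ u⊑v a a<k) (left-≤ v⊑w a a<k)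
  ; right-≥ = λ b k≤b → F.≤-trans (right-≥ v⊑w b k≤b) (right-≥ u⊑v b k≤b)
  }

Step⇒⊑ : ∀ {n k} {u v : Permutation′ n} → Step n k u v → u ⊑[ k ] v
Step⇒⊑ {k = k} {u} (step a b a<k k≤b ua<ub) = record
  { left-≤ = ∘transpose-elim (λ x y → toℕ x < k → u ⟨$⟩ʳ x F.≤ y) u a b
    (λ _ → <⇒≤ ua<ub) (λ b<k → contradiction k≤b (<⇒≱ b<k)) (λ x _ _ _ → ≤-refl)
  ; right-≥ = ∘transpose-elim (λ x y → k ≤ toℕ x → y F.≤ u ⟨$⟩ʳ x) u a b
    (λ k≤a → contradiction k≤a (<⇒≱ a<k)) (λ _ → <⇒≤ ua<ub) (λ x _ _ _ → ≤-refl)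
  }

≤[]⇒⊑ : ∀ {n k} {u w : Permutation′ n} → u ≤[ n , k ] w → u ⊑[ k ] w
≤[]⇒⊑ (done u≈w)    = ⊑-reflexive u≈w
≤[]⇒⊑ (more st v≤w) = ⊑-trans (Step⇒⊑ st) (≤[]⇒⊑ v≤w)

module _ {n : ℕ} (k : ℕ) (u w : Permutation′ n)
         (uˡ≤wˡ : ∀ a → toℕ a < k → u ⟨$⟩ʳ a F.≤ w ⟨$⟩ʳ a) where

  next : Fin n → Fin n
  next q = u ⟨$⟩ˡ (w ⟨$⟩ʳ q)

  u∘next : ∀ q → u ⟨$⟩ʳ next q ≡ w ⟨$⟩ʳ q
  u∘next q = inverseʳ u

  module _ (s : ℕ) (agree : ∀ b → k ≤ toℕ b → toℕ (u ⟨$⟩ʳ b) < s → w ⟨$⟩ʳ b ≡ u ⟨$⟩ʳ b)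
           {q : Fin n} (wq<s : toℕ (w ⟨$⟩ʳ q) < s) (uq≢wq : u ⟨$⟩ʳ q ≢ w ⟨$⟩ʳ q) where

    next≢ : next q ≢ q
    next≢ next≡q = uq≢wq (subst (λ x → u ⟨$⟩ʳ x ≡ w ⟨$⟩ʳ q) next≡q (u∘next q))

    next-left : toℕ (next q) < k
    next-left with toℕ (next q) <? k
    ... | yes next<k = next<k
    ... | no next≮k = contradiction (permutation-injective w w∘next≡wq) next≢
      where
      w∘next≡wq : w ⟨$⟩ʳ next q ≡ w ⟨$⟩ʳ q
      w∘next≡wq = trans (agree (next q) (≮⇒≥ next≮k) (subst (λ v → toℕ v < s) (sym (u∘next q)) wq<s))
                        (u∘next q)

    next-increasing : w ⟨$⟩ʳ q F.< w ⟨$⟩ʳ next q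
    next-increasing = F.≤∧≢⇒< (subst (F._≤ w ⟨$⟩ʳ next q) (u∘next q) (uˡ≤wˡ (next q) next-left))
                              (λ wq≡wnext → next≢ (permutation-injective w (sym wq≡wnext)))

  exchange-partner :
    (s : ℕ) → (∀ b → k ≤ toℕ b → toℕ (u ⟨$⟩ʳ b) < s → w ⟨$⟩ʳ b ≡ u ⟨$⟩ʳ b) →
    ∀ q → toℕ (w ⟨$⟩ʳ q) < s → u ⟨$⟩ʳ q ≢ w ⟨$⟩ʳ q →
    ∃ λ a → toℕ a < k × w ⟨$⟩ʳ q F.≤ u ⟨$⟩ʳ a ×
            toℕ (u ⟨$⟩ʳ a) < s × s ≤ toℕ (w ⟨$⟩ʳ a)
  exchange-partner s agree q wq<s uq≢wq = go q wq<s uq≢wq (<-wellFounded (s ∸ toℕ (w ⟨$⟩ʳ q)))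
    where
    go : ∀ q → toℕ (w ⟨$⟩ʳ q) < s → u ⟨$⟩ʳ q ≢ w ⟨$⟩ʳ q → Acc _<_ (s ∸ toℕ (w ⟨$⟩ʳ q)) →
         ∃ λ a → toℕ a < k × w ⟨$⟩ʳ q F.≤ u ⟨$⟩ʳ a ×
                 toℕ (u ⟨$⟩ʳ a) < s × s ≤ toℕ (w ⟨$⟩ʳ a)
    go q wq<s uq≢wq (acc rs) with s ≤? toℕ (w ⟨$⟩ʳ next q)
    ... | yes s≤wp = next q , next-left s agree wq<s uq≢wq , F.≤-reflexive (sym (u∘next q)) ,
                     subst (λ v → toℕ v < s) (sym (u∘next q)) wq<s , s≤wp
    ... | no s≰wp with go (next q) wp<s up≢wp (rs (∸-monoʳ-< wq<wp (<⇒≤ wp<s)))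
      where
      wq<wp = next-increasing s agree wq<s uq≢wq
      wp<s = ≰⇒> s≰wp
      up≢wp : u ⟨$⟩ʳ next q ≢ w ⟨$⟩ʳ next q
      up≢wp up≡wp = F.<⇒≢ wq<wp (trans (sym (u∘next q)) up≡wp)
    ...   | a , a<k , wp≤ua , ua<s , s≤wa =
            a , a<k , F.≤-trans (<⇒≤ (next-increasing s agree wq<s uq≢wq)) wp≤ua , ua<s , s≤wa

  right-agreement⇒≈ : (∀ b → k ≤ toℕ b → w ⟨$⟩ʳ b ≡ u ⟨$⟩ʳ b) → u ≈ w
  right-agreement⇒≈ agree x with u ⟨$⟩ʳ x ≟ w ⟨$⟩ʳ x
  ... | yes ux≡wx = ux≡wx
  ... | no ux≢wx with exchange-partner n (λ b k≤b _ → agree b k≤b) x (F.toℕ<n _) ux≢wx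
  ...   | _ , _ , _ , _ , n≤wa = contradiction n≤wa (<⇒≱ (F.toℕ<n _))

Excess : ∀ {n} → ℕ → Permutation′ n → Permutation′ n → Pred (Fin n) _
Excess k u w b = k ≤ toℕ b × w ⟨$⟩ʳ b F.< u ⟨$⟩ʳ b

excess? : ∀ {n} k (u w : Permutation′ n) → Decidable (Excess k u w)
excess? k u w b = (k ≤? toℕ b) ×-dec (w ⟨$⟩ʳ b F.<? u ⟨$⟩ʳ b)

deficit : ∀ {n} → Permutation′ n → Permutation′ n → ℕ
deficit w u = sum (λ x → toℕ (w ⟨$⟩ʳ x) ∸ toℕ (u ⟨$⟩ʳ x))

module _ {n k} {u w : Permutation′ n} (u⊑w : u ⊑[ k ] w) where

  ⊑∧¬Excess⇒≡ : ∀ b → k ≤ toℕ b → ¬ (w ⟨$⟩ʳ b F.< u ⟨$⟩ʳ b) → w ⟨$⟩ʳ b ≡ u ⟨$⟩ʳ b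
  ⊑∧¬Excess⇒≡ b k≤b wb≮ub = F.toℕ-injective (≤∧≮⇒≡ (right-≥ u⊑w b k≤b) wb≮ub)

  module _ {a j : Fin n} (a<k : toℕ a < k) (k≤j : k ≤ toℕ j)
           (wj≤ua : w ⟨$⟩ʳ j F.≤ u ⟨$⟩ʳ a) (ua<uj : u ⟨$⟩ʳ a F.< u ⟨$⟩ʳ j)
           (uj≤wa : u ⟨$⟩ʳ j F.≤ w ⟨$⟩ʳ a) where

    exchange-⊑ : (transpose a j ∘ₚ u) ⊑[ k ] w
    exchange-⊑ = record
      { left-≤ = ∘transpose-elim (λ x y → toℕ x < k → y F.≤ w ⟨$⟩ʳ x) u a j
          (λ _ → uj≤wa) (λ j<k → contradiction k≤j (<⇒≱ j<k)) (λ x _ _ → left-≤ u⊑w x)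
      ; right-≥ = ∘transpose-elim (λ x y → k ≤ toℕ x → w ⟨$⟩ʳ x F.≤ y) u a j
          (λ k≤a → contradiction k≤a (<⇒≱ a<k)) (λ _ → wj≤ua) (λ x _ _ → right-≥ u⊑w x)
      }

    exchange-deficit< : deficit w (transpose a j ∘ₚ u) < deficit w u
    exchange-deficit< = sum-mono-< pointwise a strict-at-a
      where
      closer : toℕ (w ⟨$⟩ʳ a) ∸ toℕ (u ⟨$⟩ʳ j) < toℕ (w ⟨$⟩ʳ a) ∸ toℕ (u ⟨$⟩ʳ a)
      closer = ∸-monoʳ-< ua<uj uj≤wa
      strict-at-a : toℕ (w ⟨$⟩ʳ a) ∸ toℕ (transpose a j ∘ₚ u ⟨$⟩ʳ a) < toℕ (w ⟨$⟩ʳ a) ∸ toℕ (u ⟨$⟩ʳ a)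
      strict-at-a rewrite ∘transpose-matchˡ u a j = closer
      pointwise : ∀ x → toℕ (w ⟨$⟩ʳ x) ∸ toℕ (transpose a j ∘ₚ u ⟨$⟩ʳ x) ≤ toℕ (w ⟨$⟩ʳ x) ∸ toℕ (u ⟨$⟩ʳ x)
      pointwise = ∘transpose-elim (λ x y → toℕ (w ⟨$⟩ʳ x) ∸ toℕ y ≤ toℕ (w ⟨$⟩ʳ x) ∸ toℕ (u ⟨$⟩ʳ x)) u a j
        (<⇒≤ closer) (≤-trans (≤-reflexive (m≤n⇒m∸n≡0 wj≤ua)) z≤n) (λ _ _ _ → ≤-refl)

  descent : ∃ (Excess k u w) →
            ∃ λ v → Step n k u v × v ⊑[ k ] w × deficit w v < deficit w u
  descent excess with ∃-minimal (excess? k u w) (λ b → toℕ (u ⟨$⟩ʳ b)) excess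
  ... | j , (k≤j , wj<uj) , minimal
      with exchange-partner k u w (left-≤ u⊑w) (toℕ (u ⟨$⟩ʳ j))
             (λ b k≤b ub<uj → ⊑∧¬Excess⇒≡ b k≤b (λ wb<ub → minimal b ub<uj (k≤b , wb<ub)))
             j wj<uj (λ uj≡wj → F.<⇒≢ wj<uj (sym uj≡wj))
  ...   | a , a<k , wj≤ua , ua<uj , uj≤wa =
          transpose a j ∘ₚ u , step a j a<k k≤j ua<uj ,
          exchange-⊑ a<k k≤j wj≤ua ua<uj uj≤wa , exchange-deficit< a<k k≤j wj≤ua ua<uj uj≤wa

⊑⇒≤[] : ∀ {n k} {u w : Permutation′ n} → u ⊑[ k ] w → u ≤[ n , k ] w
⊑⇒≤[] {n} {k} {u} {w} u⊑w = go u u⊑w (<-wellFounded (deficit w u))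
  where
  go : ∀ u → u ⊑[ k ] w → Acc _<_ (deficit w u) → u ≤[ n , k ] w
  go u u⊑w (acc rs) with F.any? (excess? k u w)
  ... | no ∄excess = done (right-agreement⇒≈ k u w (left-≤ u⊑w)
                       (λ b k≤b → ⊑∧¬Excess⇒≡ u⊑w b k≤b (λ wb<ub → ∄excess (b , k≤b , wb<ub))))
  ... | yes excess with descent u⊑w excess
  ...   | v , u→v , v⊑w , deficit< = more u→v (go v v⊑w (rs deficit<))

-- The criterion holds for all n and k.
lemma6p4 : (n k : ℕ) → 1 ≤ n → 1 ≤ k → k ≤ n → (u w : Permutation′ n) →
    (u ≤[ n , k ] w) ⇔
      (((a : Fin n) → toℕ a < k → (u ⟨$⟩ʳ a) F.≤ (w ⟨$⟩ʳ a)) ×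
       ((b : Fin n) → k ≤ toℕ b → (w ⟨$⟩ʳ b) F.≤ (u ⟨$⟩ʳ b)))
lemma6p4 n k _ _ _ u w = mk⇔
  (λ u≤w → let u⊑w = ≤[]⇒⊑ u≤w in left-≤ u⊑w , right-≥ u⊑w)
  (λ (left , right) → ⊑⇒≤[] record { left-≤ = left ; right-≥ = right })
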